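{- Let $c>1$ be odd and let $n>c$ be odd, and put $N=n-c-1$. There is a bijection between standard Young tableaux of shape $2\times N$ and lattice paths in an $N\times N$ grid, such that the parity of the area above a lattice path equals the parity of the Latin reading word of the corresponding Young tableau.
   Context: Young tableaux are standard (filled with $1,\ldots,2N$, rows and columns increasing), in English notation; the Latin reading word is obtained by reading entries row by row from top to bottom, each row from left to right, and its parity is the parity of its number of inversions. A lattice path in an $N\times N$ grid of unit squares is a path from the top-left corner to the bottom-right corner consisting of unit steps to the right or downward which stays on or above the main diagonal joining these two corners. The area above the path is the number of unit squares of the grid lying above the path (between the path and the top edge of the grid). -}

module Defs where

open import Data.Nat using (ℕ; zero; suc; _+_; _*_; _∸_; _<_; _≤_; _<ᵇ_)
open import Data.Nat.DivMod using (_%_)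
open import Data.Bool using (if_then_else_)
open import Data.List using (List; []; _∷_; map; upTo; _++_)
open import Data.List.Relation.Unary.Linked using (Linked)
open import Data.List.Relation.Binary.Permutation.Propositional using (_↭_)
open import Data.Vec using (Vec; toList)
open import Data.Vec.Relation.Binary.Pointwise.Inductive using (Pointwise)
open import Data.Product using (Σ; _×_; _,_; proj₁)
open import Relation.Binary.Bundles using (Setoid)
open import Relation.Binary.PropositionalEquality using (_≡_; setoid)
import Relation.Binary.Construct.On as On

Odd : ℕ → Set
Odd n = n % 2 ≡ 1

parity : ℕ → ℕ
parity n = n % 2

Filling : ℕ → Set
Filling N = Vec ℕ N × Vec ℕ N

topRow botRow : ∀ {N} → Filling N → Vec ℕ N
topRow (t , _) = t
botRow (_ , b) = b

readingWord : ∀ {N} → Filling N → List ℕ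
readingWord (t , b) = toList t ++ toList b

IsStandardYT : ∀ N → Filling N → Set
IsStandardYT N T =
  (readingWord T ↭ map suc (upTo (2 * N)))
  × Linked _<_ (toList (topRow T))
  × Linked _<_ (toList (botRow T))
  × Pointwise _<_ (topRow T) (botRow T)

SYT₂ : ℕ → Set
SYT₂ N = Σ (Filling N) (IsStandardYT N)

SYT₂-setoid : ℕ → Setoid _ _
SYT₂-setoid N = On.setoid {B = SYT₂ N} (setoid (Filling N)) proj₁

count< : ℕ → List ℕ → ℕ
count< x [] = 0
count< x (y ∷ ys) = (if y <ᵇ x then 1 else 0) + count< x ys

inversions : List ℕ → ℕ
inversions [] = 0
inversions (x ∷ xs) = count< x xs + inversions xs

-- Lattice paths in an N × N grid, from the top-left to the bottom-right
-- corner, with unit steps right (R) or down (D).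

data Step : Set where
  R D : Step

#R #D : List Step → ℕ
#R [] = 0
#R (R ∷ s) = suc (#R s)
#R (D ∷ s) = #R s
#D [] = 0
#D (R ∷ s) = #D s
#D (D ∷ s) = suc (#D s)

-- Staying on or above the diagonal: in every prefix, number of down
-- steps ≤ number of right steps.  `AboveDiag r d s` : after a prefix with
-- r right steps and d down steps, the rest s keeps d ≤ r throughout.
data AboveDiag : ℕ → ℕ → List Step → Set where
  done : ∀ {r d} → d ≤ r → AboveDiag r d []
  stepR : ∀ {r d s} → d ≤ r → AboveDiag (suc r) d s → AboveDiag r d (R ∷ s)
  stepD : ∀ {r d s} → d ≤ r → AboveDiag r (suc d) s → AboveDiag r d (D ∷ s)

IsLatticePath : ℕ → List Step → Set
IsLatticePath N s = (#R s ≡ N) × (#D s ≡ N) × AboveDiag 0 0 s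

LatticePath : ℕ → Set
LatticePath N = Σ (List Step) (IsLatticePath N)

LatticePath-setoid : ℕ → Setoid _ _
LatticePath-setoid N = On.setoid {B = LatticePath N} (setoid (List Step)) proj₁

-- Area above the path: a right step taken after d down steps has exactly
-- d unit squares of the grid above it (between it and the top edge).
areaFrom : ℕ → List Step → ℕ
areaFrom d [] = 0
areaFrom d (R ∷ s) = d + areaFrom d s
areaFrom d (D ∷ s) = areaFrom (suc d) s

areaAbove : List Step → ℕ
areaAbove = areaFrom 0

-- Reading 1, …, 2N in order and stepping right at each top-row entry and down at each bottom-row
-- entry turns a standard 2 × N tableau into a lattice path: rows and entries are recovered by
-- merging back, and column strictness says exactly that the i-th down step comes after the i-th
-- right step, i.e. that the path stays above the diagonal. An inversion of the reading word is a
-- top entry i exceeding a bottom entry j, i.e. a down step before a right step, which is one unit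
-- square above that right step; so the area equals the number of inversions, not only mod 2.
module Submission where

open import Defs
open import Data.Bool using (true; false; if_then_else_)
open import Data.Empty using (⊥-elim)
open import Data.List using (List; []; _∷_; _++_; _∷ʳ_; length; map; upTo; applyUpTo; iterate)
open import Data.List.Properties using (map-applyUpTo; length-++; ∷ʳ-++)
open import Data.List.Membership.Propositional using (_∈_)
open import Data.List.Membership.Propositional.Properties using (∈-++⁺ʳ)
open import Data.List.Relation.Binary.Permutation.Propositional using (_↭_; prep; ↭-sym; ↭-trans; ↭-refl)
open import Data.List.Relation.Binary.Permutation.Propositional.Properties
  using (shift; drop-∷; ∈-resp-↭; All-resp-↭; ¬x∷xs↭[])
open import Data.List.Relation.Binary.Pointwise using (Pointwise; []; _∷_)
open import Data.List.Relation.Unary.All using (All; []; _∷_) renaming (map to All-map; lookup to All-lookup)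
open import Data.List.Relation.Unary.All.Properties using (++⁺)
open import Data.List.Relation.Unary.AllPairs using (_∷_)
open import Data.List.Relation.Unary.Any using (here)
open import Data.List.Relation.Unary.Linked using (Linked; []; [-]; _∷_) renaming (tail to Linked-tail)
open import Data.List.Relation.Unary.Linked.Properties using (Linked⇒AllPairs)
open import Data.Nat using (ℕ; zero; suc; _+_; _*_; _∸_; _≤_; _<_; _<ᵇ_)
open import Data.Nat.Properties
open import Algebra.Properties.CommutativeSemigroup +-commutativeSemigroup using (x∙yz≈y∙xz; xy∙z≈y∙xz)
open import Data.Product using (Σ; _×_; _,_; proj₁; proj₂; map₁; map₂)
open import Data.Vec using (Vec; []; _∷_; toList; cast)
open import Data.Vec.Properties using (length-toList; toList-cast; toList-injective; cast-is-id)
import Data.Vec.Relation.Binary.Pointwise.Inductive as Vecʷ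
open import Function.Bundles using (Bijection)
open import Relation.Binary.PropositionalEquality
  using (_≡_; refl; sym; trans; cong; cong₂; subst; subst₂; module ≡-Reasoning)
open import Relation.Nullary using (¬_)
open import Relation.Nullary.Reflects using (ofʸ; ofⁿ)

iterate-suc-≥ : ∀ k m → All (k ≤_) (iterate suc k m)
iterate-suc-≥ k zero = []
iterate-suc-≥ k (suc m) = ≤-refl ∷ All-map <⇒≤ (iterate-suc-≥ (suc k) m)

applyUpTo-shift : ∀ k m (f : ℕ → ℕ) → (∀ i → f i ≡ k + i) → applyUpTo f m ≡ iterate suc k m
applyUpTo-shift k zero f f≗k+ = refl
applyUpTo-shift k (suc m) f f≗k+ =
  cong₂ _∷_ (trans (f≗k+ 0) (+-identityʳ k))
            (applyUpTo-shift (suc k) m (λ i → f (suc i)) (λ i → trans (f≗k+ (suc i)) (+-suc k i)))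

map-suc-upTo : ∀ m → map suc (upTo m) ≡ iterate suc 1 m
map-suc-upTo m = trans (map-applyUpTo (λ i → i) suc m) (applyUpTo-shift 1 m suc (λ i → refl))

lowerBound-of-interval : ∀ {h k m} {L : List ℕ} → L ↭ iterate suc k (suc m) →
                         h ∈ L → All (h ≤_) L → h ≡ k
lowerBound-of-interval {k = k} {m} L↭ h∈L h≤L =
  ≤-antisym (All-lookup h≤L (∈-resp-↭ (↭-sym L↭) (here refl)))
            (All-lookup (All-resp-↭ (↭-sym L↭) (iterate-suc-≥ k (suc m))) h∈L)

head≤ : ∀ {x} {xs : List ℕ} → Linked _<_ (x ∷ xs) → All (x ≤_) (x ∷ xs)
head≤ sorted with Linked⇒AllPairs <-trans sorted
... | x<xs ∷ _ = ≤-refl ∷ All-map <⇒≤ x<xs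

length-∷ʳ : ∀ (A : List ℕ) k → length (A ∷ʳ k) ≡ suc (length A)
length-∷ʳ A k = trans (length-++ A) (+-comm (length A) 1)

rightPositionsᵛ : (k : ℕ) (s : List Step) → Vec ℕ (#R s)
rightPositionsᵛ k [] = []
rightPositionsᵛ k (R ∷ s) = k ∷ rightPositionsᵛ (suc k) s
rightPositionsᵛ k (D ∷ s) = rightPositionsᵛ (suc k) s

downPositionsᵛ : (k : ℕ) (s : List Step) → Vec ℕ (#D s)
downPositionsᵛ k [] = []
downPositionsᵛ k (R ∷ s) = downPositionsᵛ (suc k) s
downPositionsᵛ k (D ∷ s) = k ∷ downPositionsᵛ (suc k) s

rightPositions downPositions : ℕ → List Step → List ℕ
rightPositions k s = toList (rightPositionsᵛ k s)
downPositions k s = toList (downPositionsᵛ k s)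

rightPositions-≥ : ∀ k s → All (k ≤_) (rightPositions k s)
rightPositions-≥ k [] = []
rightPositions-≥ k (R ∷ s) = ≤-refl ∷ All-map <⇒≤ (rightPositions-≥ (suc k) s)
rightPositions-≥ k (D ∷ s) = All-map <⇒≤ (rightPositions-≥ (suc k) s)

downPositions-≥ : ∀ k s → All (k ≤_) (downPositions k s)
downPositions-≥ k [] = []
downPositions-≥ k (R ∷ s) = All-map <⇒≤ (downPositions-≥ (suc k) s)
downPositions-≥ k (D ∷ s) = ≤-refl ∷ All-map <⇒≤ (downPositions-≥ (suc k) s)

sorted-∷ : ∀ {k} {L : List ℕ} → All (k <_) L → Linked _<_ L → Linked _<_ (k ∷ L)
sorted-∷ [] _ = [-]
sorted-∷ (k<y ∷ _) sorted = k<y ∷ sorted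

rightPositions-sorted : ∀ k s → Linked _<_ (rightPositions k s)
rightPositions-sorted k [] = []
rightPositions-sorted k (R ∷ s) = sorted-∷ (rightPositions-≥ (suc k) s) (rightPositions-sorted (suc k) s)
rightPositions-sorted k (D ∷ s) = rightPositions-sorted (suc k) s

downPositions-sorted : ∀ k s → Linked _<_ (downPositions k s)
downPositions-sorted k [] = []
downPositions-sorted k (R ∷ s) = downPositions-sorted (suc k) s
downPositions-sorted k (D ∷ s) = sorted-∷ (downPositions-≥ (suc k) s) (downPositions-sorted (suc k) s)

positions-↭ : ∀ k s → rightPositions k s ++ downPositions k s ↭ iterate suc k (length s)
positions-↭ k [] = ↭-refl
positions-↭ k (R ∷ s) = prep k (positions-↭ (suc k) s)
positions-↭ k (D ∷ s) =
  ↭-trans (shift k (rightPositions (suc k) s) (downPositions (suc k) s)) (prep k (positions-↭ (suc k) s))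

length≡#R+#D : ∀ s → length s ≡ #R s + #D s
length≡#R+#D [] = refl
length≡#R+#D (R ∷ s) = cong suc (length≡#R+#D s)
length≡#R+#D (D ∷ s) = trans (cong suc (length≡#R+#D s)) (sym (+-suc (#R s) (#D s)))

count<-≤ : ∀ x L → All (x ≤_) L → count< x L ≡ 0
count<-≤ x [] [] = refl
count<-≤ x (y ∷ ys) (x≤y ∷ x≤ys) with y <ᵇ x | <ᵇ-reflects-< y x
... | true | ofʸ y<x = ⊥-elim (<⇒≱ y<x x≤y)
... | false | _ = count<-≤ x ys x≤ys

count<-insert : ∀ x k A B → k < x → count< x (A ++ k ∷ B) ≡ suc (count< x (A ++ B))
count<-insert x k [] B k<x with k <ᵇ x | <ᵇ-reflects-< k x
... | true | _ = refl
... | false | ofⁿ k≮x = ⊥-elim (k≮x k<x)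
count<-insert x k (y ∷ A) B k<x =
  trans (cong ((if y <ᵇ x then 1 else 0) +_) (count<-insert x k A B k<x)) (+-suc _ _)

inversions-insert-least : ∀ k A B → All (k <_) A → All (k <_) B →
                          inversions (A ++ k ∷ B) ≡ length A + inversions (A ++ B)
inversions-insert-least k [] B _ k<B = cong (_+ inversions B) (count<-≤ k B (All-map <⇒≤ k<B))
inversions-insert-least k (x ∷ A) B (k<x ∷ k<A) k<B = begin
  count< x (A ++ k ∷ B) + inversions (A ++ k ∷ B)
    ≡⟨ cong₂ _+_ (count<-insert x k A B k<x) (inversions-insert-least k A B k<A k<B) ⟩
  suc (count< x (A ++ B)) + (length A + inversions (A ++ B))
    ≡⟨ cong suc (x∙yz≈y∙xz (count< x (A ++ B)) (length A) _) ⟩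
  suc (length A + (count< x (A ++ B) + inversions (A ++ B))) ∎
  where open ≡-Reasoning

-- A right step taken after d down steps is inverted with exactly those d down steps.
areaFrom≡inversions : ∀ d k s →
  areaFrom d s ≡ d * #R s + inversions (rightPositions k s ++ downPositions k s)
areaFrom≡inversions d k [] = sym (trans (+-identityʳ _) (*-zeroʳ d))
areaFrom≡inversions d k (R ∷ s) = begin
  d + areaFrom d s                              ≡⟨ cong (d +_) (areaFrom≡inversions d (suc k) s) ⟩
  d + (d * #R s + inversions P)                 ≡⟨ sym (+-assoc d _ _) ⟩
  d + d * #R s + inversions P
    ≡⟨ cong₂ _+_ (sym (*-suc d (#R s))) (cong (_+ inversions P) (sym k∉P)) ⟩
  d * suc (#R s) + (count< k P + inversions P)  ∎
  where
    open ≡-Reasoning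
    P = rightPositions (suc k) s ++ downPositions (suc k) s
    k∉P : count< k P ≡ 0
    k∉P = count<-≤ k P (All-map <⇒≤ (++⁺ (rightPositions-≥ (suc k) s) (downPositions-≥ (suc k) s)))
areaFrom≡inversions d k (D ∷ s) = begin
  areaFrom (suc d) s                      ≡⟨ areaFrom≡inversions (suc d) (suc k) s ⟩
  #R s + d * #R s + inversions (Rs ++ Ds)  ≡⟨ xy∙z≈y∙xz (#R s) (d * #R s) _ ⟩
  d * #R s + (#R s + inversions (Rs ++ Ds)) ≡⟨ cong (d * #R s +_) (sym k-inverted-with-Rs) ⟩
  d * #R s + inversions (Rs ++ k ∷ Ds)     ∎
  where
    open ≡-Reasoning
    Rs = rightPositions (suc k) s
    Ds = downPositions (suc k) s
    k-inverted-with-Rs : inversions (Rs ++ k ∷ Ds) ≡ #R s + inversions (Rs ++ Ds)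
    k-inverted-with-Rs =
      trans (inversions-insert-least k Rs Ds (rightPositions-≥ (suc k) s) (downPositions-≥ (suc k) s))
            (cong (_+ inversions (Rs ++ Ds)) (length-toList (rightPositionsᵛ (suc k) s)))

aboveDiag-≤ : ∀ {r d s} → AboveDiag r d s → d ≤ r
aboveDiag-≤ (done d≤r) = d≤r
aboveDiag-≤ (stepR d≤r _) = d≤r
aboveDiag-≤ (stepD d≤r _) = d≤r

-- A is the queue of top-row entries still waiting for the entry below them.
aboveDiag⇒columns : ∀ {r d} k s (A : List ℕ) → AboveDiag r d s → length A + d ≡ r → All (_< k) A →
                    #R s + r ≡ #D s + d → Pointwise _<_ (A ++ rightPositions k s) (downPositions k s)
aboveDiag⇒columns k [] [] _ _ _ _ = []
aboveDiag⇒columns {d = d} k [] (a ∷ A) _ |A|+d≡r _ balanced =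
  ⊥-elim (m≢1+n+m d (sym (trans |A|+d≡r balanced)))
aboveDiag⇒columns {r} {d} k (R ∷ s) A (stepR _ above) |A|+d≡r A<k balanced =
  subst (λ L → Pointwise _<_ L (downPositions (suc k) s)) (∷ʳ-++ A k (rightPositions (suc k) s))
    (aboveDiag⇒columns (suc k) s (A ∷ʳ k) above
      (trans (cong (_+ d) (length-∷ʳ A k)) (cong suc |A|+d≡r))
      (++⁺ (All-map m<n⇒m<1+n A<k) (≤-refl ∷ []))
      (trans (+-suc (#R s) r) balanced))
aboveDiag⇒columns k (D ∷ s) [] (stepD _ above) d≡r _ _ =
  ⊥-elim (<-irrefl d≡r (aboveDiag-≤ above))
aboveDiag⇒columns {d = d} k (D ∷ s) (a ∷ A) (stepD _ above) |A|+d≡r (a<k ∷ A<k) balanced =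
  a<k ∷ aboveDiag⇒columns (suc k) s A above (trans (+-suc (length A) d) |A|+d≡r)
          (All-map m<n⇒m<1+n A<k) (trans balanced (sym (+-suc (#D s) d)))

no-entry-above : ∀ {k} {L M : List ℕ} → All (k <_) L → ¬ Pointwise _<_ L (k ∷ M)
no-entry-above (k<x ∷ _) (x<k ∷ _) = <-asym x<k k<x

columns⇒aboveDiag : ∀ {r d} k s (A : List ℕ) → length A + d ≡ r → All (_< k) A →
                    Pointwise _<_ (A ++ rightPositions k s) (downPositions k s) → AboveDiag r d s
columns⇒aboveDiag {d = d} k [] A |A|+d≡r _ _ = done (subst (d ≤_) |A|+d≡r (m≤n+m d (length A)))
columns⇒aboveDiag {d = d} k (R ∷ s) A |A|+d≡r A<k columns =
  stepR (subst (d ≤_) |A|+d≡r (m≤n+m d (length A)))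
    (columns⇒aboveDiag (suc k) s (A ∷ʳ k)
      (trans (cong (_+ d) (length-∷ʳ A k)) (cong suc |A|+d≡r))
      (++⁺ (All-map m<n⇒m<1+n A<k) (≤-refl ∷ []))
      (subst (λ L → Pointwise _<_ L (downPositions (suc k) s))
             (sym (∷ʳ-++ A k (rightPositions (suc k) s))) columns))
columns⇒aboveDiag k (D ∷ s) [] _ _ columns = ⊥-elim (no-entry-above (rightPositions-≥ (suc k) s) columns)
columns⇒aboveDiag {d = d} k (D ∷ s) (a ∷ A) |A|+d≡r (_ ∷ A<k) (_ ∷ columns) =
  stepD (subst (d ≤_) |A|+d≡r (m≤n+m d (suc (length A))))
    (columns⇒aboveDiag (suc k) s A (trans (+-suc (length A) d) |A|+d≡r)
                       (All-map m<n⇒m<1+n A<k) columns)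

interleave : List ℕ → List ℕ → List Step
interleave [] [] = []
interleave [] (y ∷ ys) = D ∷ interleave [] ys
interleave (x ∷ xs) [] = R ∷ interleave xs []
interleave (x ∷ xs) (y ∷ ys) =
  if x <ᵇ y then R ∷ interleave xs (y ∷ ys) else D ∷ interleave (x ∷ xs) ys

interleave-∷ˡ : ∀ k P Q → All (k <_) Q → interleave (k ∷ P) Q ≡ R ∷ interleave P Q
interleave-∷ˡ k P [] _ = refl
interleave-∷ˡ k P (y ∷ ys) (k<y ∷ _) with k <ᵇ y | <ᵇ-reflects-< k y
... | true | _ = refl
... | false | ofⁿ k≮y = ⊥-elim (k≮y k<y)

interleave-∷ʳ : ∀ k P Q → All (k <_) P → interleave P (k ∷ Q) ≡ D ∷ interleave P Q
interleave-∷ʳ k [] Q _ = refl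
interleave-∷ʳ k (x ∷ xs) Q (k<x ∷ _) with x <ᵇ k | <ᵇ-reflects-< x k
... | true | ofʸ x<k = ⊥-elim (<-asym x<k k<x)
... | false | _ = refl

interleave-positions : ∀ k s → interleave (rightPositions k s) (downPositions k s) ≡ s
interleave-positions k [] = refl
interleave-positions k (R ∷ s) =
  trans (interleave-∷ˡ k _ _ (downPositions-≥ (suc k) s)) (cong (R ∷_) (interleave-positions (suc k) s))
interleave-positions k (D ∷ s) =
  trans (interleave-∷ʳ k _ _ (rightPositions-≥ (suc k) s)) (cong (D ∷_) (interleave-positions (suc k) s))

-- The first step of the interleaving goes to the least entry, which must be k.
positions-interleave : ∀ k m {t b} → Linked _<_ t → Linked _<_ b → t ++ b ↭ iterate suc k m →
  rightPositions k (interleave t b) ≡ t × downPositions k (interleave t b) ≡ b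
positions-interleave k m {[]} {[]} _ _ _ = refl , refl
positions-interleave k zero {x ∷ xs} _ _ t++b↭ = ⊥-elim (¬x∷xs↭[] t++b↭)
positions-interleave k zero {[]} {y ∷ ys} _ _ t++b↭ = ⊥-elim (¬x∷xs↭[] t++b↭)
positions-interleave k (suc m) {[]} {y ∷ ys} _ b-sorted t++b↭
  with refl ← lowerBound-of-interval t++b↭ (here refl) (head≤ b-sorted) =
  map₂ (cong (k ∷_)) (positions-interleave (suc k) m [] (Linked-tail b-sorted) (drop-∷ t++b↭))
positions-interleave k (suc m) {x ∷ xs} {[]} t-sorted _ t++b↭
  with refl ← lowerBound-of-interval t++b↭ (here refl) (++⁺ (head≤ t-sorted) []) =
  map₁ (cong (k ∷_)) (positions-interleave (suc k) m (Linked-tail t-sorted) [] (drop-∷ t++b↭))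
positions-interleave k (suc m) {x ∷ xs} {y ∷ ys} t-sorted b-sorted t++b↭
  with x <ᵇ y | <ᵇ-reflects-< x y
... | true | ofʸ x<y
  with refl ← lowerBound-of-interval t++b↭ (here refl)
                (++⁺ (head≤ t-sorted) (All-map (≤-trans (<⇒≤ x<y)) (head≤ b-sorted))) =
  map₁ (cong (k ∷_)) (positions-interleave (suc k) m (Linked-tail t-sorted) b-sorted (drop-∷ t++b↭))
... | false | ofⁿ x≮y
  with refl ← lowerBound-of-interval t++b↭ (∈-++⁺ʳ (x ∷ xs) (here refl))
                (++⁺ (All-map (≤-trans (≮⇒≥ x≮y)) (head≤ t-sorted)) (head≤ b-sorted)) =
  map₂ (cong (k ∷_)) (positions-interleave (suc k) m t-sorted (Linked-tail b-sorted)
                        (drop-∷ (↭-trans (↭-sym (shift k (x ∷ xs) ys)) t++b↭)))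

Pointwise-toList : ∀ {n} {u v : Vec ℕ n} →
                   Vecʷ.Pointwise _<_ u v → Pointwise _<_ (toList u) (toList v)
Pointwise-toList Vecʷ.[] = []
Pointwise-toList (x<y Vecʷ.∷ u<v) = x<y ∷ Pointwise-toList u<v

Pointwise-fromList : ∀ {n} (u v : Vec ℕ n) →
                     Pointwise _<_ (toList u) (toList v) → Vecʷ.Pointwise _<_ u v
Pointwise-fromList [] [] [] = Vecʷ.[]
Pointwise-fromList (x ∷ u) (y ∷ v) (x<y ∷ u<v) = x<y Vecʷ.∷ Pointwise-fromList u v u<v

toList-injective′ : ∀ {n} (u v : Vec ℕ n) → toList u ≡ toList v → u ≡ v
toList-injective′ u v u≡v = trans (sym (cast-is-id refl u)) (toList-injective refl u v u≡v)

tableauPath : ∀ {N} → Filling N → List Step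
tableauPath (t , b) = interleave (toList t) (toList b)

positions-tableauPath : ∀ {N} (T : SYT₂ N) →
  rightPositions 1 (tableauPath (proj₁ T)) ≡ toList (topRow (proj₁ T)) ×
  downPositions 1 (tableauPath (proj₁ T)) ≡ toList (botRow (proj₁ T))
positions-tableauPath {N} ((t , b) , entries , t-sorted , b-sorted , _) =
  positions-interleave 1 (2 * N) t-sorted b-sorted
    (subst (readingWord (t , b) ↭_) (map-suc-upTo (2 * N)) entries)

tableauPath-isLatticePath : ∀ {N} (T : SYT₂ N) → IsLatticePath N (tableauPath (proj₁ T))
tableauPath-isLatticePath T@((t , b) , _ , _ , _ , columns) =
  trans (sym (length-toList (rightPositionsᵛ 1 s))) (trans (cong length rights≡t) (length-toList t)) ,
  trans (sym (length-toList (downPositionsᵛ 1 s))) (trans (cong length downs≡b) (length-toList b)) ,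
  columns⇒aboveDiag 1 s [] refl []
    (subst₂ (Pointwise _<_) (sym rights≡t) (sym downs≡b) (Pointwise-toList columns))
  where
    s = tableauPath (proj₁ T)
    rights≡t = proj₁ (positions-tableauPath T)
    downs≡b = proj₂ (positions-tableauPath T)

toPath : ∀ {N} → SYT₂ N → LatticePath N
toPath T = tableauPath (proj₁ T) , tableauPath-isLatticePath T

area≡inversions : ∀ {N} (T : SYT₂ N) →
                  areaAbove (tableauPath (proj₁ T)) ≡ inversions (readingWord (proj₁ T))
area≡inversions T =
  trans (areaFrom≡inversions 0 1 (tableauPath (proj₁ T)))
        (cong₂ (λ t b → inversions (t ++ b))
               (proj₁ (positions-tableauPath T)) (proj₂ (positions-tableauPath T)))

tableauPath-injective : ∀ {N} (T T′ : SYT₂ N) →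
                        tableauPath (proj₁ T) ≡ tableauPath (proj₁ T′) → proj₁ T ≡ proj₁ T′
tableauPath-injective T@((t , b) , _) T′@((t′ , b′) , _) same-path =
  cong₂ _,_
    (toList-injective′ t t′ (trans (sym (proj₁ (positions-tableauPath T)))
      (trans (cong (rightPositions 1) same-path) (proj₁ (positions-tableauPath T′)))))
    (toList-injective′ b b′ (trans (sym (proj₂ (positions-tableauPath T)))
      (trans (cong (downPositions 1) same-path) (proj₂ (positions-tableauPath T′)))))

fromPath : ∀ {N} → LatticePath N → SYT₂ N
fromPath {N} (s , #R≡N , #D≡N , above) =
  (u , v) ,
  subst₂ (λ U V → U ++ V ↭ map suc (upTo (2 * N))) (sym u≡) (sym v≡)
    (subst (_ ↭_) (trans (cong (iterate suc 1) length≡2N) (sym (map-suc-upTo (2 * N))))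
           (positions-↭ 1 s)) ,
  subst (Linked _<_) (sym u≡) (rightPositions-sorted 1 s) ,
  subst (Linked _<_) (sym v≡) (downPositions-sorted 1 s) ,
  Pointwise-fromList u v (subst₂ (Pointwise _<_) (sym u≡) (sym v≡)
    (aboveDiag⇒columns 1 s [] above refl [] (cong (_+ 0) (trans #R≡N (sym #D≡N)))))
  where
    u = cast #R≡N (rightPositionsᵛ 1 s)
    v = cast #D≡N (downPositionsᵛ 1 s)
    u≡ : toList u ≡ rightPositions 1 s
    u≡ = toList-cast #R≡N (rightPositionsᵛ 1 s)
    v≡ : toList v ≡ downPositions 1 s
    v≡ = toList-cast #D≡N (downPositionsᵛ 1 s)
    length≡2N : length s ≡ 2 * N
    length≡2N =
      trans (length≡#R+#D s) (trans (cong₂ _+_ #R≡N #D≡N) (cong (N +_) (sym (+-identityʳ N))))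

tableauPath-fromPath : ∀ {N} (P : LatticePath N) → tableauPath (proj₁ (fromPath P)) ≡ proj₁ P
tableauPath-fromPath (s , #R≡N , #D≡N , _) =
  trans (cong₂ interleave (toList-cast #R≡N (rightPositionsᵛ 1 s))
                          (toList-cast #D≡N (downPositionsᵛ 1 s)))
        (interleave-positions 1 s)

mainTheorem8 : (c n : ℕ) → 1 < c → Odd c → c < n → Odd n →
    let N = n ∸ c ∸ 1 in
    Σ (Bijection (SYT₂-setoid N) (LatticePath-setoid N)) λ f →
    (T : SYT₂ N) →
    parity (areaAbove (proj₁ (Bijection.to f T))) ≡ parity (inversions (readingWord (proj₁ T)))
-- The hypotheses on c and n only fix N; the bijection works for every N.
mainTheorem8 c n _ _ _ _ =
  record
    { to = toPath
    ; cong = cong tableauPath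
    ; bijective = (λ {T} {T′} → tableauPath-injective T T′) ,
                  (λ P → fromPath P , λ {T} T≡ → trans (cong tableauPath T≡) (tableauPath-fromPath P))
    } ,
  λ T → cong parity (area≡inversions T)
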